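{- Let $r\ge 2$, $k\ge 1$ and $n\ge 2r$ be integers, and let $G_n$ be the graph with vertex set $\{(i,X) : 1\le i\le k,\ X\subseteq[n],\ |X|=r\}$, where $(i,X)$ and $(j,Y)$ are adjacent iff either $i=j$ and $X\cap Y=\emptyset$, or $i\ne j$ and $X\cap Y\ne\emptyset$. For an ordered partition $\mathcal S=(S_1,\dots,S_k)$ of $[n]$ into pairwise disjoint (possibly empty) sets, each of which is either empty or has at least $r$ elements, let $\alpha(\mathcal S)$ be the maximum size of an independent set of $G_n$ all of whose vertices $(i,X)$ satisfy $X\subseteq S_i$. Suppose $\mathcal S$ has at least two nonempty parts and $r\le |S_i|\le 2r-2$ for some $i$. Let $j\ne i$ with $S_j\ne\emptyset$, and let $\mathcal S'$ be obtained from $\mathcal S$ by replacing $S_i$ with $S_i\cup S_j$ and $S_j$ with $\emptyset$. Then $\alpha(\mathcal S')\ge \alpha(\mathcal S)$.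
   Context: $[n]=\{1,\dots,n\}$. An independent set is a set of pairwise non-adjacent vertices. -}

module Defs where

open import Data.Nat using (ℕ; _≤_)
open import Data.Fin using (Fin; _≟_)
open import Data.Fin.Subset using (Subset; _∈_; _⊆_; ∣_∣; Nonempty; Empty; _∩_; _∪_; ⊥)
open import Data.Product using (_×_; Σ; ∃; ∃₂; _,_)
open import Data.Sum using (_⊎_)
open import Data.List using (List; length)
open import Data.List.Membership.Propositional using () renaming (_∈_ to _∈ₗ_)
open import Data.List.Relation.Unary.Unique.Propositional using (Unique)
open import Relation.Binary.PropositionalEquality using (_≡_; _≢_)
open import Relation.Nullary using (¬_; yes; no)

-- A vertex of G_n is a pair (i , X) with i ∈ Fin k (representing [k]) and X ⊆ [n].
-- (The requirement |X| = r is imposed by IsVertex.)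
Vertex : ℕ → ℕ → Set
Vertex k n = Fin k × Subset n

IsVertex : ∀ {k n} → ℕ → Vertex k n → Set
IsVertex r (i , X) = ∣ X ∣ ≡ r

Adj : ∀ {k n} → Vertex k n → Vertex k n → Set
Adj (i , X) (j , Y) = (i ≡ j × Empty (X ∩ Y)) ⊎ (i ≢ j × Nonempty (X ∩ Y))

IsIndepIn : ∀ {k n} → ℕ → (Fin k → Subset n) → List (Vertex k n) → Set
IsIndepIn r S I =
  Unique I
  × (∀ {v} → v ∈ₗ I → IsVertex r v)
  × (∀ {i X} → (i , X) ∈ₗ I → X ⊆ S i)
  × (∀ {u v} → u ∈ₗ I → v ∈ₗ I → ¬ Adj u v)

IsAlpha : ∀ {k n} → ℕ → (Fin k → Subset n) → ℕ → Set
IsAlpha r S m =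
  (Σ (List _) λ I → IsIndepIn r S I × length I ≡ m)
  × (∀ I → IsIndepIn r S I → length I ≤ m)

IsAdmissiblePartition : ∀ {k n} → ℕ → (Fin k → Subset n) → Set
IsAdmissiblePartition r S =
  (∀ a b → a ≢ b → Empty (S a ∩ S b))
  × (∀ x → ∃ λ a → x ∈ S a)
  × (∀ a → Empty (S a) ⊎ r ≤ ∣ S a ∣)

merge : ∀ {k n} → (Fin k → Subset n) → Fin k → Fin k → Fin k → Subset n
merge S i j l with l ≟ i
... | yes _ = S i ∪ S j
... | no _ with l ≟ j
...   | yes _ = ⊥
...   | no _ = S l

-- An independent set I for S has its vertices of colour i among the r-subsets of Si, those
-- of colour j form an intersecting family B of r-subsets of Sj (equal colours must meet),
-- and its other vertices avoid Si ∪ Sj.  It therefore suffices to map the sets of colours i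
-- and j injectively to r-subsets of Si ∪ Sj through one point x ∈ Si: recoloured with i,
-- they pairwise meet, and with the untouched vertices they form an independent set of the
-- same size for the merged partition.
--
-- The r-subsets of Si through x stay put, and one avoiding x goes to (Si ─ T) ∪ Z for a
-- fixed Z ⊆ Sj through y with ∣ Z ∣ = 2r − ∣ Si ∣ ≥ 2.  If ∣ Sj ∣ ≥ 2r, the Erdős–Ko–Rado
-- theorem, proved in injective form by compressions, sends B into the r-subsets of Sj
-- through y, and the shift y ↦ x moves these into Si ∪ Sj, away from y.  If ∣ Sj ∣ < 2r,
-- members of B through y are shifted the same way, and those avoiding y go to explicit
-- sets missed by all other images.

module Submission where

open import Defs
open import Data.Bool.Properties using () renaming (_≟_ to _≟ᵇ_)
open import Data.Empty using (⊥-elim)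
open import Data.Fin using (Fin)
open import Data.Fin.Properties using () renaming (_≟_ to _≟ᶠ_)
open import Data.Fin.Subset
open import Data.Fin.Subset.Properties
open import Data.List using (List; []; _∷_; map; filter; allFin; length)
open import Data.List.Membership.Propositional using () renaming (_∈_ to _∈ₗ_; _∉_ to _∉ₗ_)
open import Data.List.Membership.Propositional.Properties using (∈-map⁻; ∈-map⁺; ∈-filter⁻; ∈-filter⁺; ∈-allFin)
open import Data.List.Properties using (length-map)
import Data.List.Relation.Unary.All as All
open import Data.List.Relation.Unary.AllPairs using (_∷_)
open import Data.List.Relation.Unary.Any using (here; there; any?)
open import Data.List.Relation.Unary.Unique.Propositional using (Unique; [])
open import Data.Nat using (ℕ; zero; suc; _+_; _*_; _∸_; _≤_; _<_; z≤n; s≤s)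
open import Data.Nat.Properties
open import Algebra.Properties.CommutativeSemigroup +-commutativeSemigroup using (x∙yz≈y∙xz)
open import Data.Product using (_×_; _,_; proj₁; proj₂; ∃; ∃₂)
open import Data.Sum using (_⊎_; inj₁; inj₂; [_,_]′)
open import Data.Vec using ([]; _∷_; here; there)
open import Data.Vec.Properties using (≡-dec)
open import Function using (_∘_; id)
open import Relation.Binary.PropositionalEquality
open import Relation.Nullary using (¬_; ¬?; Dec; yes; no)
open import Relation.Unary using (Decidable)

private variable
  A : Set
  P P′ Q Q′ R : A → Set
  n r : ℕ
  x y e z : Fin n
  p q U X Y : Subset n
  F G : List (Subset n)

-- Cardinalities of finite subsets

x∈p─q⇒x∉q : ∀ (p q : Subset n) → x ∈ p ─ q → x ∉ q
x∈p─q⇒x∉q (_ ∷ p) (inside  ∷ q) (there x∈) (there x∈q) = x∈p─q⇒x∉q p q x∈ x∈q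
x∈p─q⇒x∉q (_ ∷ p) (outside ∷ q) (there x∈) (there x∈q) = x∈p─q⇒x∉q p q x∈ x∈q

x∈p-y⇒x≢y : x ∈ p - y → x ≢ y
x∈p-y⇒x≢y {x = x} {p} {y} x∈ refl = x∈p─q⇒x∉q p ⁅ y ⁆ x∈ (x∈⁅x⁆ y)

∣p∪q∣+∣p∩q∣≡∣p∣+∣q∣ : ∀ (p q : Subset n) → ∣ p ∪ q ∣ + ∣ p ∩ q ∣ ≡ ∣ p ∣ + ∣ q ∣
∣p∪q∣+∣p∩q∣≡∣p∣+∣q∣ [] [] = refl
∣p∪q∣+∣p∩q∣≡∣p∣+∣q∣ (inside ∷ p) (inside ∷ q) =
  cong suc (trans (+-suc _ _) (trans (cong suc (∣p∪q∣+∣p∩q∣≡∣p∣+∣q∣ p q)) (sym (+-suc _ _))))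
∣p∪q∣+∣p∩q∣≡∣p∣+∣q∣ (inside ∷ p) (outside ∷ q) = cong suc (∣p∪q∣+∣p∩q∣≡∣p∣+∣q∣ p q)
∣p∪q∣+∣p∩q∣≡∣p∣+∣q∣ (outside ∷ p) (inside ∷ q) =
  trans (cong suc (∣p∪q∣+∣p∩q∣≡∣p∣+∣q∣ p q)) (sym (+-suc _ _))
∣p∪q∣+∣p∩q∣≡∣p∣+∣q∣ (outside ∷ p) (outside ∷ q) = ∣p∪q∣+∣p∩q∣≡∣p∣+∣q∣ p q

∣p∣≡∣p∩q∣+∣p─q∣ : ∀ (p q : Subset n) → ∣ p ∣ ≡ ∣ p ∩ q ∣ + ∣ p ─ q ∣
∣p∣≡∣p∩q∣+∣p─q∣ [] [] = refl
∣p∣≡∣p∩q∣+∣p─q∣ (inside ∷ p) (inside ∷ q) = cong suc (∣p∣≡∣p∩q∣+∣p─q∣ p q)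
∣p∣≡∣p∩q∣+∣p─q∣ (inside ∷ p) (outside ∷ q) = trans (cong suc (∣p∣≡∣p∩q∣+∣p─q∣ p q)) (sym (+-suc _ _))
∣p∣≡∣p∩q∣+∣p─q∣ (outside ∷ p) (inside ∷ q) = ∣p∣≡∣p∩q∣+∣p─q∣ p q
∣p∣≡∣p∩q∣+∣p─q∣ (outside ∷ p) (outside ∷ q) = ∣p∣≡∣p∩q∣+∣p─q∣ p q

x∈p⇒⁅x⁆⊆p : x ∈ p → ⁅ x ⁆ ⊆ p
x∈p⇒⁅x⁆⊆p {x = x} {p} x∈p y∈⁅x⁆ = subst (_∈ p) (sym (x∈⁅y⁆⇒x≡y x y∈⁅x⁆)) x∈p

Empty⇒∣p∣≡0 : Empty p → ∣ p ∣ ≡ 0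
Empty⇒∣p∣≡0 {n} p-empty = trans (cong ∣_∣ (Empty-unique p-empty)) (∣⊥∣≡0 n)

Nonempty⇒0<∣p∣ : Nonempty p → 0 < ∣ p ∣
Nonempty⇒0<∣p∣ {p = p} (x , x∈p) =
  subst (_≤ ∣ p ∣) (∣⁅x⁆∣≡1 x) (p⊆q⇒∣p∣≤∣q∣ (x∈p⇒⁅x⁆⊆p x∈p))

0<∣p∣⇒Nonempty : 0 < ∣ p ∣ → Nonempty p
0<∣p∣⇒Nonempty {p = p} 0<∣p∣ with nonempty? p
... | yes p-nonempty = p-nonempty
... | no p-empty = ⊥-elim (<-irrefl (sym (Empty⇒∣p∣≡0 p-empty)) 0<∣p∣)

∣p∪q∣≡∣p∣+∣q∣ : ∀ (p q : Subset n) → Empty (p ∩ q) → ∣ p ∪ q ∣ ≡ ∣ p ∣ + ∣ q ∣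
∣p∪q∣≡∣p∣+∣q∣ p q disjoint = begin
  ∣ p ∪ q ∣             ≡⟨ sym (+-identityʳ _) ⟩
  ∣ p ∪ q ∣ + 0         ≡⟨ cong (∣ p ∪ q ∣ +_) (sym (Empty⇒∣p∣≡0 disjoint)) ⟩
  ∣ p ∪ q ∣ + ∣ p ∩ q ∣ ≡⟨ ∣p∪q∣+∣p∩q∣≡∣p∣+∣q∣ p q ⟩
  ∣ p ∣ + ∣ q ∣         ∎
  where open ≡-Reasoning

q⊆p⇒∣p∣≡∣q∣+∣p─q∣ : ∀ (p q : Subset n) → q ⊆ p → ∣ p ∣ ≡ ∣ q ∣ + ∣ p ─ q ∣
q⊆p⇒∣p∣≡∣q∣+∣p─q∣ p q q⊆p = trans (∣p∣≡∣p∩q∣+∣p─q∣ p q) (cong (λ t → ∣ t ∣ + ∣ p ─ q ∣) p∩q≡q)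
  where
  p∩q≡q : p ∩ q ≡ q
  p∩q≡q = ⊆-antisym (p∩q⊆q p q) (λ x∈q → x∈p∩q⁺ (q⊆p x∈q , x∈q))

x∈p⇒∣p∣≡1+∣p-x∣ : x ∈ p → ∣ p ∣ ≡ suc ∣ p - x ∣
x∈p⇒∣p∣≡1+∣p-x∣ {x = x} {p} x∈p =
  trans (q⊆p⇒∣p∣≡∣q∣+∣p─q∣ p ⁅ x ⁆ (x∈p⇒⁅x⁆⊆p x∈p))
        (cong (_+ ∣ p - x ∣) (∣⁅x⁆∣≡1 x))

x∉p⇒Empty[p∩⁅x⁆] : x ∉ p → Empty (p ∩ ⁅ x ⁆)
x∉p⇒Empty[p∩⁅x⁆] {x = x} {p} x∉p (y , y∈) with x∈p∩q⁻ p ⁅ x ⁆ y∈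
... | y∈p , y∈⁅x⁆ = x∉p (subst (_∈ p) (x∈⁅y⁆⇒x≡y x y∈⁅x⁆) y∈p)

x∉p⇒∣p∪⁅x⁆∣≡1+∣p∣ : x ∉ p → ∣ p ∪ ⁅ x ⁆ ∣ ≡ suc ∣ p ∣
x∉p⇒∣p∪⁅x⁆∣≡1+∣p∣ {x = x} {p} x∉p =
  trans (∣p∪q∣≡∣p∣+∣q∣ p ⁅ x ⁆ (x∉p⇒Empty[p∩⁅x⁆] x∉p)) (trans (cong (∣ p ∣ +_) (∣⁅x⁆∣≡1 x)) (+-comm ∣ p ∣ 1))

∃-⊆-of-size : ∀ c (p : Subset n) → c ≤ ∣ p ∣ → ∃ λ q → q ⊆ p × ∣ q ∣ ≡ c
∃-⊆-of-size {n} zero p _ = ⊥ , (λ x∈⊥ → ⊥-elim (∉⊥ x∈⊥)) , ∣⊥∣≡0 n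
∃-⊆-of-size (suc c) (inside ∷ p) (s≤s c≤∣p∣) with ∃-⊆-of-size c p c≤∣p∣
... | q , q⊆p , ∣q∣≡c = inside ∷ q , s⊆s q⊆p , cong suc ∣q∣≡c
∃-⊆-of-size (suc c) (outside ∷ p) c<∣p∣ with ∃-⊆-of-size (suc c) p c<∣p∣
... | q , q⊆p , ∣q∣≡c = outside ∷ q , out⊆ q⊆p , ∣q∣≡c

∣p∣<∣q∣⇒∃x∈q∖p : ∀ (p q : Subset n) → ∣ p ∣ < ∣ q ∣ → ∃ λ x → x ∈ q × x ∉ p
∣p∣<∣q∣⇒∃x∈q∖p p q ∣p∣<∣q∣ with 0<∣p∣⇒Nonempty {p = q ─ p} (n≢0⇒n>0 ∣q─p∣≢0)
  where
  ∣q─p∣≢0 : ∣ q ─ p ∣ ≢ 0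
  ∣q─p∣≢0 ∣q─p∣≡0 = <⇒≱ ∣p∣<∣q∣ (begin
    ∣ q ∣                 ≡⟨ ∣p∣≡∣p∩q∣+∣p─q∣ q p ⟩
    ∣ q ∩ p ∣ + ∣ q ─ p ∣ ≡⟨ cong (∣ q ∩ p ∣ +_) ∣q─p∣≡0 ⟩
    ∣ q ∩ p ∣ + 0         ≡⟨ +-identityʳ _ ⟩
    ∣ q ∩ p ∣             ≤⟨ ∣p∩q∣≤∣q∣ q p ⟩
    ∣ p ∣                 ∎)
    where open ≤-Reasoning
... | x , x∈q─p = x , p─q⊆p q p x∈q─p , x∈p─q⇒x∉q q p x∈q─p

∪-cancelʳ : ∀ {p q s : Subset n} → Empty (p ∩ s) → Empty (q ∩ s) → p ∪ s ≡ q ∪ s → p ≡ q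
∪-cancelʳ {p = p} {q} {s} p∩s-empty q∩s-empty eq =
  ⊆-antisym (transfer p∩s-empty eq) (transfer q∩s-empty (sym eq))
  where
  transfer : ∀ {t u} → Empty (t ∩ s) → t ∪ s ≡ u ∪ s → t ⊆ u
  transfer {t} {u} t∩s-empty eq′ x∈t with x∈p∪q⁻ u s (subst (_ ∈_) eq′ (p⊆p∪q s x∈t))
  ... | inj₁ x∈u = x∈u
  ... | inj₂ x∈s = ⊥-elim (t∩s-empty (_ , x∈p∩q⁺ (x∈t , x∈s)))

─-injective : ∀ {u p q : Subset n} → p ⊆ u → q ⊆ u → u ─ p ≡ u ─ q → p ≡ q
─-injective {u = u} {p} {q} p⊆u q⊆u eq = ⊆-antisym (transfer p⊆u eq) (transfer q⊆u (sym eq))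
  where
  transfer : ∀ {t v} → t ⊆ u → u ─ t ≡ u ─ v → t ⊆ v
  transfer {t} {v} t⊆u eq′ {x} x∈t with x ∈? v
  ... | yes x∈v = x∈v
  ... | no x∉v = ⊥-elim (x∈p─q⇒x∉q u t (subst (x ∈_) (sym eq′) (x∈p∧x∉q⇒x∈p─q (t⊆u x∈t) x∉v)) x∈t)

-‿injective : x ∈ p → x ∈ q → p - x ≡ q - x → p ≡ q
-‿injective {x = x} {p} {q} x∈p x∈q eq = ⊆-antisym (transfer x∈q eq) (transfer x∈p (sym eq))
  where
  transfer : ∀ {t v} → x ∈ v → t - x ≡ v - x → t ⊆ v
  transfer {t} {v} x∈v eq′ {y} y∈t with y ≟ᶠ x
  ... | yes refl = x∈v
  ... | no y≢x = p─q⊆p v ⁅ x ⁆ (subst (y ∈_) eq′ (x∈p∧x≢y⇒x∈p-y y∈t y≢x))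

x∈p∧∣p∣≡1⇒p≡⁅x⁆ : x ∈ p → ∣ p ∣ ≡ 1 → p ≡ ⁅ x ⁆
x∈p∧∣p∣≡1⇒p≡⁅x⁆ {x = x} {p} x∈p ∣p∣≡1 = ⊆-antisym p⊆⁅x⁆ (x∈p⇒⁅x⁆⊆p x∈p)
  where
  p⊆⁅x⁆ : p ⊆ ⁅ x ⁆
  p⊆⁅x⁆ {y} y∈p with y ≟ᶠ x
  ... | yes refl = x∈⁅x⁆ x
  ... | no y≢x = ⊥-elim (<-irrefl (sym (suc-injective (trans (sym (x∈p⇒∣p∣≡1+∣p-x∣ x∈p)) ∣p∣≡1)))
                                  (Nonempty⇒0<∣p∣ (y , x∈p∧x≢y⇒x∈p-y y∈p y≢x)))

∃-other-element : x ∈ p → 1 < ∣ p ∣ → ∃ λ y → y ∈ p × y ≢ x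
∃-other-element {x = x} {p} x∈p 1<∣p∣ with 0<∣p∣⇒Nonempty {p = p - x}
  (≤-pred (subst (1 <_) (x∈p⇒∣p∣≡1+∣p-x∣ x∈p) 1<∣p∣))
... | y , y∈p-x = y , p─q⊆p p ⁅ x ⁆ y∈p-x , x∈p-y⇒x≢y y∈p-x

p⊆q∧∣p∣≡∣q∣⇒p≡q : p ⊆ q → ∣ p ∣ ≡ ∣ q ∣ → p ≡ q
p⊆q∧∣p∣≡∣q∣⇒p≡q {p = p} {q} p⊆q ∣p∣≡∣q∣ = ⊆-antisym p⊆q q⊆p
  where
  q⊆p : q ⊆ p
  q⊆p {v} v∈q with v ∈? p
  ... | yes v∈p = v∈p
  ... | no v∉p = ⊥-elim (<-irrefl ∣p∣≡∣q∣ (p⊂q⇒∣p∣<∣q∣ (p⊆q , v , v∈q , v∉p)))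

⊆p-x⇒x∉ : q ⊆ p - x → x ∉ q
⊆p-x⇒x∉ q⊆p-x x∈q = x∈p-y⇒x≢y (q⊆p-x x∈q) refl

⊆p-x⇒∪⁅x⁆⊆p : x ∈ p → q ⊆ p - x → q ∪ ⁅ x ⁆ ⊆ p
⊆p-x⇒∪⁅x⁆⊆p {x = x} {p} {q} x∈p q⊆p-x y∈ with x∈p∪q⁻ q ⁅ x ⁆ y∈
... | inj₁ y∈q   = p─q⊆p p ⁅ x ⁆ (q⊆p-x y∈q)
... | inj₂ y∈⁅x⁆ = x∈p⇒⁅x⁆⊆p x∈p y∈⁅x⁆

∃-⊆-of-size-∋ : ∀ c → x ∈ p → suc c ≤ ∣ p ∣ → ∃ λ q → q ⊆ p × x ∈ q × ∣ q ∣ ≡ suc c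
∃-⊆-of-size-∋ {x = x} {p} c x∈p 1+c≤∣p∣
  with ∃-⊆-of-size c (p - x) (≤-pred (subst (suc c ≤_) (x∈p⇒∣p∣≡1+∣p-x∣ x∈p) 1+c≤∣p∣))
... | q , q⊆p-x , ∣q∣≡c = q ∪ ⁅ x ⁆ , ⊆p-x⇒∪⁅x⁆⊆p x∈p q⊆p-x , q⊆p∪q q ⁅ x ⁆ (x∈⁅x⁆ x) ,
  trans (x∉p⇒∣p∪⁅x⁆∣≡1+∣p∣ (⊆p-x⇒x∉ q⊆p-x)) (cong suc ∣q∣≡c)

-- Injections between predicates

record InjectsInto {A : Set} (P Q : A → Set) : Set where
  field
    to        : A → A
    injective : ∀ {a b} → P a → P b → to a ≡ to b → a ≡ b
    maps      : ∀ {a} → P a → Q (to a)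

open InjectsInto public

⊆⇒InjectsInto : (∀ {a} → P a → Q a) → InjectsInto P Q
⊆⇒InjectsInto P⊆Q = record { to = id ; injective = λ _ _ eq → eq ; maps = P⊆Q }

InjectsInto-trans : InjectsInto P Q → InjectsInto Q R → InjectsInto P R
InjectsInto-trans f g = record
  { to        = to g ∘ to f
  ; injective = λ Pa Pb eq → injective f Pa Pb (injective g (maps f Pa) (maps f Pb) eq)
  ; maps      = maps g ∘ maps f
  }

InjectsInto-⊆ : (∀ {a} → P′ a → P a) → (∀ {a} → Q a → Q′ a) → InjectsInto P Q → InjectsInto P′ Q′
InjectsInto-⊆ P′⊆P Q⊆Q′ f = record
  { to        = to f
  ; injective = λ P′a P′b → injective f (P′⊆P P′a) (P′⊆P P′b)
  ; maps      = Q⊆Q′ ∘ maps f ∘ P′⊆P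
  }

InjectsInto-if : {A : Set} {D P Q₁ Q₂ : A → Set} (D? : Decidable D) →
  InjectsInto (λ a → P a × D a) Q₁ → InjectsInto (λ a → P a × ¬ D a) Q₂ →
  (∀ {a} → Q₁ a → ¬ Q₂ a) → InjectsInto P (λ a → Q₁ a ⊎ Q₂ a)
InjectsInto-if {A} {D} {P} {Q₁} {Q₂} D? f g disjoint = record
  { to = branch ; injective = injective′ ; maps = maps′ }
  where
  branch : A → A
  branch a with D? a
  ... | yes _ = to f a
  ... | no  _ = to g a
  injective′ : ∀ {a b} → P a → P b → branch a ≡ branch b → a ≡ b
  injective′ {a} {b} Pa Pb eq with D? a | D? b
  ... | yes Da | yes Db = injective f (Pa , Da) (Pb , Db) eq
  ... | no ¬Da | no ¬Db = injective g (Pa , ¬Da) (Pb , ¬Db) eq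
  ... | yes Da | no ¬Db = ⊥-elim (disjoint (maps f (Pa , Da)) (subst Q₂ (sym eq) (maps g (Pb , ¬Db))))
  ... | no ¬Da | yes Db = ⊥-elim (disjoint (maps f (Pb , Db)) (subst Q₂ eq (maps g (Pa , ¬Da))))
  maps′ : ∀ {a} → P a → Q₁ (branch a) ⊎ Q₂ (branch a)
  maps′ {a} Pa with D? a
  ... | yes Da = inj₁ (maps f (Pa , Da))
  ... | no ¬Da = inj₂ (maps g (Pa , ¬Da))

Unique-map⁺ : ∀ {f : A → A} {xs : List A} →
  (∀ {a b} → a ∈ₗ xs → b ∈ₗ xs → f a ≡ f b → a ≡ b) → Unique xs → Unique (map f xs)
Unique-map⁺ {xs = []} _ [] = []
Unique-map⁺ {f = f} {xs = a ∷ xs} inj (a∉xs ∷ xs!) =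
  All.tabulate (λ fb∈ fa≡fb → let (b , b∈xs , fb≡) = ∈-map⁻ f fb∈ in
    All.lookup a∉xs b∈xs (inj (here refl) (there b∈xs) (trans fa≡fb fb≡)))
  ∷ Unique-map⁺ (λ a∈ b∈ → inj (there a∈) (there b∈)) xs!

subsingleton-InjectsInto : ∀ {b} → (∀ {a a′} → P a → P a′ → a ≡ a′) → Q b → InjectsInto P Q
subsingleton-InjectsInto {b = b} P-subsingleton Qb =
  record { to = λ _ → b ; injective = λ Pa Pa′ _ → P-subsingleton Pa Pa′ ; maps = λ _ → Qb }

-- Uniform and intersecting families, and compressions

_∈_choose_ : Subset n → Subset n → ℕ → Set
X ∈ U choose r = X ⊆ U × ∣ X ∣ ≡ r

Star : ℕ → Subset n → Fin n → Subset n → Set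
Star r U x X = X ∈ U choose r × x ∈ X

Uniform : ℕ → Subset n → List (Subset n) → Set
Uniform r U F = ∀ {X} → X ∈ₗ F → X ∈ U choose r

Intersecting : List (Subset n) → Set
Intersecting F = ∀ {X Y} → X ∈ₗ F → Y ∈ₗ F → Nonempty (X ∩ Y)

shift : Fin n → Fin n → Subset n → Subset n
shift e z X = (X - e) ∪ ⁅ z ⁆

∈-shift : ∀ e z (X : Subset n) → z ∈ shift e z X
∈-shift e z X = q⊆p∪q (X - e) ⁅ z ⁆ (x∈⁅x⁆ z)

∉-shift : e ≢ z → e ∉ shift e z X
∉-shift {e = e} {z} {X} e≢z e∈ with x∈p∪q⁻ (X - e) ⁅ z ⁆ e∈
... | inj₁ e∈X-e = x∈p-y⇒x≢y e∈X-e refl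
... | inj₂ e∈⁅z⁆ = e≢z (x∈⁅y⁆⇒x≡y z e∈⁅z⁆)

∈-shift⁻ : ∀ {w} → w ∈ shift e z X → w ≢ z → w ∈ X × w ≢ e
∈-shift⁻ {e = e} {z} {X} w∈ w≢z with x∈p∪q⁻ (X - e) ⁅ z ⁆ w∈
... | inj₁ w∈X-e = p─q⊆p X ⁅ e ⁆ w∈X-e , x∈p-y⇒x≢y w∈X-e
... | inj₂ w∈⁅z⁆ = ⊥-elim (w≢z (x∈⁅y⁆⇒x≡y z w∈⁅z⁆))

∈-shift⁺ : ∀ {w} → w ∈ X → w ≢ e → w ∈ shift e z X
∈-shift⁺ {X = X} {e = e} {z = z} w∈X w≢e = p⊆p∪q ⁅ z ⁆ (x∈p∧x≢y⇒x∈p-y w∈X w≢e)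

shift-⊆ : X ⊆ U → z ∈ U → shift e z X ⊆ U
shift-⊆ {X = X} {U = U} {z = z} {e = e} X⊆U z∈U w∈ with x∈p∪q⁻ (X - e) ⁅ z ⁆ w∈
... | inj₁ w∈X-e = X⊆U (p─q⊆p X ⁅ e ⁆ w∈X-e)
... | inj₂ w∈⁅z⁆ = x∈p⇒⁅x⁆⊆p z∈U w∈⁅z⁆

shift-size : e ∈ X → z ∉ X → ∣ shift e z X ∣ ≡ ∣ X ∣
shift-size {e = e} {X = X} {z = z} e∈X z∉X =
  trans (x∉p⇒∣p∪⁅x⁆∣≡1+∣p∣ (z∉X ∘ p─q⊆p X ⁅ e ⁆)) (sym (x∈p⇒∣p∣≡1+∣p-x∣ e∈X))

shift-injective : e ∈ X → z ∉ X → e ∈ Y → z ∉ Y → shift e z X ≡ shift e z Y → X ≡ Y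
shift-injective {e = e} {X = X} {z = z} {Y = Y} e∈X z∉X e∈Y z∉Y eq =
  -‿injective e∈X e∈Y (∪-cancelʳ (x∉p⇒Empty[p∩⁅x⁆] (z∉X ∘ p─q⊆p X ⁅ e ⁆))
                                 (x∉p⇒Empty[p∩⁅x⁆] (z∉Y ∘ p─q⊆p Y ⁅ e ⁆)) eq)

_∈ₗ?_ : (X : Subset n) (F : List (Subset n)) → Dec (X ∈ₗ F)
X ∈ₗ? F = any? (≡-dec _≟ᵇ_ X) F

compress : Fin n → Fin n → List (Subset n) → Subset n → Subset n
compress e z F X with e ∈? X | z ∈? X | shift e z X ∈ₗ? F
... | yes _ | no _ | no _ = shift e z X
... | _     | _    | _    = X

data CompressView (e z : Fin n) (F : List (Subset n)) (X : Subset n) : Subset n → Set where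
  shifted : e ∈ X → z ∉ X → shift e z X ∉ₗ F → CompressView e z F X (shift e z X)
  kept    : (e ∈ X → z ∉ X → shift e z X ∈ₗ F) → CompressView e z F X X

compress-view : ∀ (e z : Fin n) F X → CompressView e z F X (compress e z F X)
compress-view e z F X with e ∈? X | z ∈? X | shift e z X ∈ₗ? F
... | yes e∈X | no z∉X | no  s∉F = shifted e∈X z∉X s∉F
... | yes _   | no _   | yes s∈F = kept (λ _ _ → s∈F)
... | yes _   | yes z∈X | _      = kept (λ _ z∉X → ⊥-elim (z∉X z∈X))
... | no e∉X  | _      | _       = kept (λ e∈X → ⊥-elim (e∉X e∈X))

compressed : Fin n → Fin n → List (Subset n) → List (Subset n)
compressed e z F = map (compress e z F) F

compress-injectsInto : ∀ (e z : Fin n) F → InjectsInto (_∈ₗ F) (_∈ₗ compressed e z F)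
compress-injectsInto e z F = record
  { to = compress e z F ; injective = injective′ ; maps = ∈-map⁺ (compress e z F) }
  where
  injective′ : ∀ {X Y} → X ∈ₗ F → Y ∈ₗ F → compress e z F X ≡ compress e z F Y → X ≡ Y
  injective′ {X} {Y} X∈F Y∈F eq
    with compress e z F X | compress-view e z F X | compress e z F Y | compress-view e z F Y
  ... | _ | shifted e∈X z∉X _ | _ | shifted e∈Y z∉Y _ = shift-injective e∈X z∉X e∈Y z∉Y eq
  ... | _ | shifted _ _ sX∉F  | _ | kept _            = ⊥-elim (sX∉F (subst (_∈ₗ F) (sym eq) Y∈F))
  ... | _ | kept _            | _ | shifted _ _ sY∉F  = ⊥-elim (sY∉F (subst (_∈ₗ F) eq X∈F))
  ... | _ | kept _            | _ | kept _            = eq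

compressed-uniform : z ∈ U → Uniform r U F → Uniform r U (compressed e z F)
compressed-uniform {z = z} {F = F} {e = e} z∈U F-uniform Y∈ with ∈-map⁻ (compress e z F) Y∈
... | X , X∈F , refl with compress e z F X | compress-view e z F X | F-uniform X∈F
...   | _ | shifted e∈X z∉X _ | X⊆U , ∣X∣≡r = shift-⊆ X⊆U z∈U , trans (shift-size e∈X z∉X) ∣X∣≡r
...   | _ | kept _            | X-sized = X-sized

∩-Nonempty-comm : ∀ {p q : Subset n} → Nonempty (p ∩ q) → Nonempty (q ∩ p)
∩-Nonempty-comm {p = p} {q} = subst Nonempty (∩-comm p q)

shifted-meets-kept : Intersecting F → X ∈ₗ F → Y ∈ₗ F → e ∈ X → z ∉ X →
  (e ∈ Y → z ∉ Y → shift e z Y ∈ₗ F) → Nonempty (shift e z X ∩ Y)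
shifted-meets-kept {F = F} {X = X} {Y = Y} {e = e} {z = z} F-int X∈F Y∈F e∈X z∉X Y-kept
  with z ∈? Y | e ∈? Y
... | yes z∈Y | _ = z , x∈p∩q⁺ (∈-shift e z X , z∈Y)
... | no z∉Y | no e∉Y with F-int X∈F Y∈F
...   | w , w∈X∩Y = let (w∈X , w∈Y) = x∈p∩q⁻ X Y w∈X∩Y in
  w , x∈p∩q⁺ (∈-shift⁺ w∈X (λ w≡e → e∉Y (subst (_∈ Y) w≡e w∈Y)) , w∈Y)
shifted-meets-kept {X = X} {Y = Y} {e = e} {z = z} F-int X∈F Y∈F e∈X z∉X Y-kept
  | no z∉Y | yes e∈Y with F-int X∈F (Y-kept e∈Y z∉Y)
...   | w , w∈X∩sY =
  let (w∈X , w∈sY) = x∈p∩q⁻ X (shift e z Y) w∈X∩sY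
      (w∈Y , w≢e) = ∈-shift⁻ w∈sY (λ w≡z → z∉X (subst (_∈ X) w≡z w∈X))
  in w , x∈p∩q⁺ (∈-shift⁺ w∈X w≢e , w∈Y)

compressed-intersecting : Intersecting F → Intersecting (compressed e z F)
compressed-intersecting {F = F} {e = e} {z = z} F-int X′∈ Y′∈
  with ∈-map⁻ (compress e z F) X′∈ | ∈-map⁻ (compress e z F) Y′∈
... | X , X∈F , refl | Y , Y∈F , refl
  with compress e z F X | compress-view e z F X | compress e z F Y | compress-view e z F Y
... | _ | shifted _ _ _ | _ | shifted _ _ _ = z , x∈p∩q⁺ (∈-shift e z X , ∈-shift e z Y)
... | _ | shifted e∈X z∉X _ | _ | kept Y-kept = shifted-meets-kept F-int X∈F Y∈F e∈X z∉X Y-kept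
... | _ | kept X-kept | _ | shifted e∈Y z∉Y _ =
  ∩-Nonempty-comm (shifted-meets-kept F-int Y∈F X∈F e∈Y z∉Y X-kept)
... | _ | kept _ | _ | kept _ = F-int X∈F Y∈F

Stable : Fin n → Fin n → List (Subset n) → Set
Stable e z F = ∀ {X} → X ∈ₗ F → e ∈ X → z ∉ X → shift e z X ∈ₗ F

∉⇒∈-compressed : X ∈ₗ F → e ∉ X → X ∈ₗ compressed e z F
∉⇒∈-compressed {X = X} {F = F} {e = e} {z = z} X∈F e∉X =
  subst (_∈ₗ compressed e z F) (compress-∉ (compress-view e z F X)) (∈-map⁺ (compress e z F) X∈F)
  where
  compress-∉ : ∀ {Y} → CompressView e z F X Y → Y ≡ X
  compress-∉ (shifted e∈X _ _) = ⊥-elim (e∉X e∈X)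
  compress-∉ (kept _)          = refl

∈-compressed⁻ : X ∈ₗ compressed e z F → e ∈ X → X ∈ₗ F × (z ∉ X → shift e z X ∈ₗ F)
∈-compressed⁻ {e = e} {z = z} {F = F} X∈ e∈X with ∈-map⁻ (compress e z F) X∈
... | Y , Y∈F , refl with compress e z F Y | compress-view e z F Y
...   | _ | shifted e∈Y z∉Y _ = ⊥-elim (∉-shift (λ e≡z → z∉Y (subst (_∈ Y) e≡z e∈Y)) e∈X)
...   | _ | kept Y-kept = Y∈F , Y-kept e∈X

compressed-stable : ∀ (e z : Fin n) F → Stable e z (compressed e z F)
compressed-stable e z F X∈ e∈X z∉X =
  ∉⇒∈-compressed (proj₂ (∈-compressed⁻ X∈ e∈X) z∉X) (∉-shift (λ e≡z → z∉X (subst (_∈ _) e≡z e∈X)))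

compressed-preserves-stable : ∀ {z′ : Fin n} → Stable e z F → Stable e z (compressed e z′ F)
compressed-preserves-stable F-stable X∈ e∈X z∉X =
  ∉⇒∈-compressed (F-stable (proj₁ (∈-compressed⁻ X∈ e∈X)) e∈X z∉X)
                 (∉-shift (λ e≡z → z∉X (subst (_∈ _) e≡z e∈X)))

compressAll : Fin n → List (Fin n) → List (Subset n) → List (Subset n)
compressAll e []       F = F
compressAll e (z ∷ zs) F = compressAll e zs (compressed e z F)

module _ (e : Fin n) where

  compressAll-injectsInto : ∀ zs F → InjectsInto (_∈ₗ F) (_∈ₗ compressAll e zs F)
  compressAll-injectsInto []       F = ⊆⇒InjectsInto id
  compressAll-injectsInto (z ∷ zs) F =
    InjectsInto-trans (compress-injectsInto e z F) (compressAll-injectsInto zs (compressed e z F))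

  compressAll-uniform : ∀ zs F → (∀ {z} → z ∈ₗ zs → z ∈ U) → Uniform r U F → Uniform r U (compressAll e zs F)
  compressAll-uniform []       F _     F-uniform = F-uniform
  compressAll-uniform (z ∷ zs) F zs⊆U F-uniform =
    compressAll-uniform zs _ (zs⊆U ∘ there) (compressed-uniform {e = e} (zs⊆U (here refl)) F-uniform)

  compressAll-intersecting : ∀ zs F → Intersecting F → Intersecting (compressAll e zs F)
  compressAll-intersecting []       F F-int = F-int
  compressAll-intersecting (z ∷ zs) F F-int =
    compressAll-intersecting zs _ (compressed-intersecting {e = e} {z = z} F-int)

  compressAll-preserves-stable : ∀ zs F → Stable e z F → Stable e z (compressAll e zs F)
  compressAll-preserves-stable []       F F-stable = F-stable
  compressAll-preserves-stable (z′ ∷ zs) F F-stable =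
    compressAll-preserves-stable zs _ (compressed-preserves-stable {z′ = z′} F-stable)

  compressAll-stable : ∀ zs F → z ∈ₗ zs → Stable e z (compressAll e zs F)
  compressAll-stable (z ∷ zs) F (here refl) = compressAll-preserves-stable zs _ (compressed-stable e z F)
  compressAll-stable (_ ∷ zs) F (there z∈zs) = compressAll-stable zs _ z∈zs

-- The Erdős–Ko–Rado theorem

deletion : Fin n → List (Subset n) → List (Subset n)
deletion e G = filter (¬? ∘ (e ∈?_)) G

link : Fin n → List (Subset n) → List (Subset n)
link e G = map (_- e) (filter (e ∈?_) G)

deletion-uniform : Uniform r U G → Uniform r (U - e) (deletion e G)
deletion-uniform {G = G} {e = e} G-uniform X∈ with ∈-filter⁻ (¬? ∘ (e ∈?_)) {xs = G} X∈
... | X∈G , e∉X = (λ x∈X → x∈p∧x≢y⇒x∈p-y (proj₁ (G-uniform X∈G) x∈X) (λ { refl → e∉X x∈X })) ,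
                  proj₂ (G-uniform X∈G)

deletion-intersecting : Intersecting G → Intersecting (deletion e G)
deletion-intersecting {G = G} {e = e} G-int X∈ Y∈ =
  G-int (proj₁ (∈-filter⁻ (¬? ∘ (e ∈?_)) {xs = G} X∈)) (proj₁ (∈-filter⁻ (¬? ∘ (e ∈?_)) {xs = G} Y∈))

∈-link⁻ : ∀ {X} → X ∈ₗ link e G → ∃ λ Y → Y ∈ₗ G × e ∈ Y × X ≡ Y - e
∈-link⁻ {e = e} {G = G} X∈ with ∈-map⁻ (_- e) X∈
... | Y , Y∈ , refl = let (Y∈G , e∈Y) = ∈-filter⁻ (e ∈?_) {xs = G} Y∈ in Y , Y∈G , e∈Y , refl

link-uniform : Uniform (suc r) U G → Uniform r (U - e) (link e G)
link-uniform G-uniform X∈ with ∈-link⁻ X∈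
... | Y , Y∈G , e∈Y , refl = let (Y⊆U , ∣Y∣≡1+r) = G-uniform Y∈G in
  (λ x∈ → x∈p∧x≢y⇒x∈p-y (Y⊆U (p─q⊆p _ _ x∈)) (x∈p-y⇒x≢y x∈)) ,
  suc-injective (trans (sym (x∈p⇒∣p∣≡1+∣p-x∣ e∈Y)) ∣Y∣≡1+r)

-- If two members through e met only in e, a point z outside their union would exist,
-- and stability would put shift e z Y into G, disjoint from Y′.
link-intersecting : Uniform r U G → Intersecting G → (∀ {z} → z ∈ U → Stable e z G) →
  r + r ≤ ∣ U ∣ → Intersecting (link e G)
link-intersecting {r = r} {U = U} {G = G} {e = e} G-uniform G-int G-stable 2r≤∣U∣ X∈ X′∈
  with ∈-link⁻ X∈ | ∈-link⁻ X′∈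
... | Y , Y∈G , e∈Y , refl | Y′ , Y′∈G , e∈Y′ , refl with nonempty? ((Y - e) ∩ (Y′ - e))
...   | yes meet = meet
...   | no disjoint with ∣p∣<∣q∣⇒∃x∈q∖p (Y ∪ Y′) U ∣Y∪Y′∣<∣U∣
  where
  ∣Y∪Y′∣<∣U∣ : ∣ Y ∪ Y′ ∣ < ∣ U ∣
  ∣Y∪Y′∣<∣U∣ = begin-strict
    ∣ Y ∪ Y′ ∣                ≡⟨ +-identityʳ _ ⟨
    ∣ Y ∪ Y′ ∣ + 0            <⟨ +-monoʳ-< ∣ Y ∪ Y′ ∣ (Nonempty⇒0<∣p∣ (e , x∈p∩q⁺ (e∈Y , e∈Y′))) ⟩
    ∣ Y ∪ Y′ ∣ + ∣ Y ∩ Y′ ∣   ≡⟨ ∣p∪q∣+∣p∩q∣≡∣p∣+∣q∣ Y Y′ ⟩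
    ∣ Y ∣ + ∣ Y′ ∣            ≡⟨ cong₂ _+_ (proj₂ (G-uniform Y∈G)) (proj₂ (G-uniform Y′∈G)) ⟩
    r + r                     ≤⟨ 2r≤∣U∣ ⟩
    ∣ U ∣                     ∎
    where open ≤-Reasoning
...     | z , z∈U , z∉Y∪Y′ with G-int (G-stable z∈U Y∈G e∈Y (z∉Y∪Y′ ∘ p⊆p∪q Y′)) Y′∈G
...       | w , w∈ =
  let (w∈sY , w∈Y′) = x∈p∩q⁻ _ Y′ w∈
      (w∈Y , w≢e) = ∈-shift⁻ w∈sY (λ { refl → z∉Y∪Y′ (q⊆p∪q Y Y′ w∈Y′) })
  in ⊥-elim (disjoint (w , x∈p∩q⁺ (x∈p∧x≢y⇒x∈p-y w∈Y w≢e , x∈p∧x≢y⇒x∈p-y w∈Y′ w≢e)))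

singletons-injectsInto-star : ∀ {B} → y ∈ U → Uniform 1 U B → Intersecting B → InjectsInto (_∈ₗ B) (Star 1 U y)
singletons-injectsInto-star {y = y} {U = U} y∈U B-uniform B-int =
  subsingleton-InjectsInto all-equal ((x∈p⇒⁅x⁆⊆p y∈U , ∣⁅x⁆∣≡1 y) , x∈⁅x⁆ y)
  where
  all-equal : ∀ {X Y} → X ∈ₗ _ → Y ∈ₗ _ → X ≡ Y
  all-equal {X} {Y} X∈ Y∈ with B-int X∈ Y∈
  ... | w , w∈ = let (w∈X , w∈Y) = x∈p∩q⁻ X Y w∈ in
    trans (x∈p∧∣p∣≡1⇒p≡⁅x⁆ w∈X (proj₂ (B-uniform X∈))) (sym (x∈p∧∣p∣≡1⇒p≡⁅x⁆ w∈Y (proj₂ (B-uniform Y∈))))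

-- When ∣ U ∣ = 2r, complementation in U matches the members avoiding y with r-sets through y,
-- and none of these is already in B since B is intersecting.
halves-injectsInto-star : ∀ {B} → ∣ U ∣ ≡ r + r → y ∈ U → Uniform r U B → Intersecting B →
  InjectsInto (_∈ₗ B) (Star r U y)
halves-injectsInto-star {U = U} {r = r} {y = y} {B = B} ∣U∣≡2r y∈U B-uniform B-int =
  InjectsInto-⊆ id [ proj₁ , proj₁ ]′
    (InjectsInto-if (y ∈?_) through-y complemented disjoint)
  where
  through-y : InjectsInto (λ X → X ∈ₗ B × y ∈ X) (λ V → Star r U y V × V ∈ₗ B)
  through-y = ⊆⇒InjectsInto λ (X∈ , y∈X) → (B-uniform X∈ , y∈X) , X∈
  complemented : InjectsInto (λ X → X ∈ₗ B × y ∉ X) (λ V → Star r U y V × ∃ λ X → X ∈ₗ B × Empty (V ∩ X))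
  complemented = record
    { to = U ─_
    ; injective = λ (X∈ , _) (Y∈ , _) → ─-injective (proj₁ (B-uniform X∈)) (proj₁ (B-uniform Y∈))
    ; maps = λ {X} (X∈ , y∉X) →
        ((p─q⊆p U X , ∣U─X∣≡r X∈) , x∈p∧x∉q⇒x∈p─q y∈U y∉X) ,
        X , X∈ , λ (w , w∈) → let (w∈U─X , w∈X) = x∈p∩q⁻ (U ─ X) X w∈ in x∈p─q⇒x∉q U X w∈U─X w∈X
    }
    where
    ∣U─X∣≡r : ∀ {X} → X ∈ₗ B → ∣ U ─ X ∣ ≡ r
    ∣U─X∣≡r {X} X∈ = let (X⊆U , ∣X∣≡r) = B-uniform X∈ in
      +-cancelˡ-≡ r _ _ (trans (cong (_+ ∣ U ─ X ∣) (sym ∣X∣≡r))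
                               (trans (sym (q⊆p⇒∣p∣≡∣q∣+∣p─q∣ U X X⊆U)) ∣U∣≡2r))
  disjoint : ∀ {V} → Star r U y V × V ∈ₗ B → ¬ (Star r U y V × ∃ λ X → X ∈ₗ B × Empty (V ∩ X))
  disjoint (_ , V∈) (_ , X , X∈ , V∩X-empty) = V∩X-empty (B-int V∈ X∈)

insert-injectsInto-star : e ∈ U → InjectsInto (Star r (U - e) y) (λ V → Star (suc r) U y V × e ∈ V)
insert-injectsInto-star {e = e} {U = U} e∈U = record
  { to = _∪ ⁅ e ⁆
  ; injective = λ ((X⊆ , _) , _) ((Y⊆ , _) , _) →
      ∪-cancelʳ (x∉p⇒Empty[p∩⁅x⁆] (⊆p-x⇒x∉ X⊆)) (x∉p⇒Empty[p∩⁅x⁆] (⊆p-x⇒x∉ Y⊆))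
  ; maps = λ {X} ((X⊆ , ∣X∣≡r) , y∈X) →
      ((⊆p-x⇒∪⁅x⁆⊆p e∈U X⊆ , trans (x∉p⇒∣p∪⁅x⁆∣≡1+∣p∣ (⊆p-x⇒x∉ X⊆)) (cong suc ∣X∣≡r)) , p⊆p∪q ⁅ e ⁆ y∈X) ,
      q⊆p∪q X ⁅ e ⁆ (x∈⁅x⁆ e)
  }

link-deletion-injectsInto-star : e ∈ U →
  InjectsInto (_∈ₗ deletion e G) (Star (suc r) (U - e) y) →
  InjectsInto (_∈ₗ link e G) (Star r (U - e) y) →
  InjectsInto (_∈ₗ G) (Star (suc r) U y)
link-deletion-injectsInto-star {e = e} {U = U} {G = G} {r = r} {y = y} e∈U κ₀ κ₁ =
  InjectsInto-⊆ id [ proj₁ , proj₁ ]′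
    (InjectsInto-if (e ∈?_) through-e avoiding-e (λ (_ , e∈V) (_ , e∉V) → e∉V e∈V))
  where
  remove-e : InjectsInto (λ X → X ∈ₗ G × e ∈ X) (_∈ₗ link e G)
  remove-e = record
    { to = _- e
    ; injective = λ (_ , e∈X) (_ , e∈Y) → -‿injective e∈X e∈Y
    ; maps = λ (X∈ , e∈X) → ∈-map⁺ (_- e) (∈-filter⁺ (e ∈?_) X∈ e∈X)
    }
  through-e : InjectsInto (λ X → X ∈ₗ G × e ∈ X) (λ V → Star (suc r) U y V × e ∈ V)
  through-e = InjectsInto-trans remove-e (InjectsInto-trans κ₁ (insert-injectsInto-star e∈U))
  avoiding-e : InjectsInto (λ X → X ∈ₗ G × e ∉ X) (λ V → Star (suc r) U y V × e ∉ V)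
  avoiding-e = InjectsInto-trans (⊆⇒InjectsInto λ (X∈ , e∉X) → ∈-filter⁺ (¬? ∘ (e ∈?_)) X∈ e∉X)
    (InjectsInto-⊆ id
       (λ ((V⊆ , ∣V∣) , y∈V) → ((p─q⊆p U ⁅ e ⁆ ∘ V⊆ , ∣V∣) , y∈V) , ⊆p-x⇒x∉ V⊆) κ₀)

elements : Subset n → List (Fin n)
elements U = filter (_∈? U) (allFin _)

-- The Erdős–Ko–Rado theorem in injective form, by induction on ∣ U ∣ via compression
-- towards an element e ≠ y and splitting into the link and deletion of e.
intersecting-injectsInto-star : ∀ m {U : Subset n} → ∣ U ∣ ≡ m → 0 < r → r + r ≤ m → y ∈ U →
  ∀ {B} → Uniform r U B → Intersecting B → InjectsInto (_∈ₗ B) (Star r U y)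
intersecting-injectsInto-star {r = suc zero} m _ _ _ y∈U = singletons-injectsInto-star y∈U
intersecting-injectsInto-star {r = suc (suc r)} zero _ _ ()
intersecting-injectsInto-star {r = suc (suc r)} {y = y} (suc m) {U} ∣U∣≡1+m _ 2r≤1+m y∈U {B} B-uniform B-int
  with suc m ≟ suc (suc r) + suc (suc r)
... | yes 1+m≡2r = halves-injectsInto-star (trans ∣U∣≡1+m 1+m≡2r) y∈U B-uniform B-int
... | no 1+m≢2r
  with ∃-other-element y∈U (≤-trans (s≤s (s≤s z≤n)) (subst (suc (suc r) + suc (suc r) ≤_) (sym ∣U∣≡1+m) 2r≤1+m))
...   | e , e∈U , e≢y =
  InjectsInto-trans (compressAll-injectsInto e (elements U) B) (link-deletion-injectsInto-star e∈U κ₀ κ₁)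
  where
  2r≤∣U∣ : suc (suc r) + suc (suc r) ≤ ∣ U ∣
  2r≤∣U∣ = subst (_ ≤_) (sym ∣U∣≡1+m) 2r≤1+m
  2r≤m : suc (suc r) + suc (suc r) ≤ m
  2r≤m = ≤-pred (≤∧≢⇒< 2r≤1+m (1+m≢2r ∘ sym))
  ∣U-e∣≡m : ∣ U - e ∣ ≡ m
  ∣U-e∣≡m = suc-injective (trans (sym (x∈p⇒∣p∣≡1+∣p-x∣ e∈U)) ∣U∣≡1+m)
  y∈U-e : y ∈ U - e
  y∈U-e = x∈p∧x≢y⇒x∈p-y y∈U (e≢y ∘ sym)
  B′ = compressAll e (elements U) B
  B′-uniform : Uniform (suc (suc r)) U B′
  B′-uniform = compressAll-uniform e (elements U) B
                 (λ z∈ → proj₂ (∈-filter⁻ (_∈? U) {xs = allFin _} z∈)) B-uniform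
  B′-int : Intersecting B′
  B′-int = compressAll-intersecting e (elements U) B B-int
  B′-stable : ∀ {z} → z ∈ U → Stable e z B′
  B′-stable z∈U = compressAll-stable e (elements U) B (∈-filter⁺ (_∈? U) (∈-allFin _) z∈U)
  κ₀ : InjectsInto (_∈ₗ deletion e B′) (Star (suc (suc r)) (U - e) y)
  κ₀ = intersecting-injectsInto-star m ∣U-e∣≡m (s≤s z≤n) 2r≤m y∈U-e
         (deletion-uniform B′-uniform) (deletion-intersecting B′-int)
  κ₁ : InjectsInto (_∈ₗ link e B′) (Star (suc r) (U - e) y)
  κ₁ = intersecting-injectsInto-star m ∣U-e∣≡m (s≤s z≤n)
         (≤-trans (+-mono-≤ (n≤1+n (suc r)) (n≤1+n (suc r))) 2r≤m) y∈U-e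
         (link-uniform B′-uniform)
         (link-intersecting B′-uniform B′-int B′-stable 2r≤∣U∣)

-- Merging two parts

module MergedStar {n r : ℕ} {Si Sj : Subset n} {x y : Fin n}
  (Si∩Sj-empty : Empty (Si ∩ Sj)) (x∈Si : x ∈ Si) (y∈Sj : y ∈ Sj) where

  ∉Sj : ∀ {v} → v ∈ Si → v ∉ Sj
  ∉Sj v∈Si v∈Sj = Si∩Sj-empty (_ , x∈p∩q⁺ (v∈Si , v∈Sj))

  ⊆Si-⊆Sj-disjoint : ∀ {A B} → A ⊆ Si → B ⊆ Sj → Empty (A ∩ B)
  ⊆Si-⊆Sj-disjoint {A} {B} A⊆Si B⊆Sj (v , v∈) =
    let (v∈A , v∈B) = x∈p∩q⁻ A B v∈ in ∉Sj (A⊆Si v∈A) (B⊆Sj v∈B)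

  ⊆Si∪Sj : ∀ {A B} → A ⊆ Si → B ⊆ Sj → A ∪ B ⊆ Si ∪ Sj
  ⊆Si∪Sj {A} {B} A⊆Si B⊆Sj v∈ = [ p⊆p∪q Sj ∘ A⊆Si , q⊆p∪q Si Sj ∘ B⊆Sj ]′ (x∈p∪q⁻ A B v∈)

  Target : Subset n → Set
  Target = Star r (Si ∪ Sj) x

  module _ {Z : Subset n} (Z⊆Sj : Z ⊆ Sj) (∣Si∣+∣Z∣≡2r : ∣ Si ∣ + ∣ Z ∣ ≡ r + r) where

    padded-complement-injectsInto : InjectsInto (λ T → T ∈ Si choose r × x ∉ T) (λ V → Target V × Z ⊆ V)
    padded-complement-injectsInto = record
      { to = λ T → (Si ─ T) ∪ Z
      ; injective = λ ((T⊆ , _) , _) ((T′⊆ , _) , _) →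
          ─-injective T⊆ T′⊆ ∘
            ∪-cancelʳ (⊆Si-⊆Sj-disjoint (p─q⊆p Si _) Z⊆Sj) (⊆Si-⊆Sj-disjoint (p─q⊆p Si _) Z⊆Sj)
      ; maps = λ {T} ((T⊆ , ∣T∣≡r) , x∉T) →
          ((⊆Si∪Sj (p─q⊆p Si T) Z⊆Sj , size T⊆ ∣T∣≡r) , p⊆p∪q Z (x∈p∧x∉q⇒x∈p─q x∈Si x∉T)) , q⊆p∪q (Si ─ T) Z
      }
      where
      size : ∀ {T} → T ⊆ Si → ∣ T ∣ ≡ r → ∣ (Si ─ T) ∪ Z ∣ ≡ r
      size {T} T⊆ ∣T∣≡r = begin
        ∣ (Si ─ T) ∪ Z ∣   ≡⟨ ∣p∪q∣≡∣p∣+∣q∣ (Si ─ T) Z (⊆Si-⊆Sj-disjoint (p─q⊆p Si T) Z⊆Sj) ⟩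
        ∣ Si ─ T ∣ + ∣ Z ∣ ≡⟨ +-cancelˡ-≡ r _ _ (begin
          r + (∣ Si ─ T ∣ + ∣ Z ∣)     ≡⟨ +-assoc r _ _ ⟨
          r + ∣ Si ─ T ∣ + ∣ Z ∣       ≡⟨ cong (λ t → t + ∣ Si ─ T ∣ + ∣ Z ∣) ∣T∣≡r ⟨
          ∣ T ∣ + ∣ Si ─ T ∣ + ∣ Z ∣   ≡⟨ cong (_+ ∣ Z ∣) (q⊆p⇒∣p∣≡∣q∣+∣p─q∣ Si T T⊆) ⟨
          ∣ Si ∣ + ∣ Z ∣               ≡⟨ ∣Si∣+∣Z∣≡2r ⟩
          r + r                        ∎) ⟩
        r                  ∎
        where open ≡-Reasoning

    Si-choose-injectsInto : y ∈ Z → InjectsInto (_∈ Si choose r) (λ V → Target V × (V ⊆ Si ⊎ Z ⊆ V))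
    Si-choose-injectsInto y∈Z =
      InjectsInto-⊆ id [ (λ (V∈ , V⊆Si) → V∈ , inj₁ V⊆Si) , (λ (V∈ , Z⊆V) → V∈ , inj₂ Z⊆V) ]′
        (InjectsInto-if (x ∈?_) through-x padded-complement-injectsInto
           (λ (_ , V⊆Si) (_ , Z⊆V) → ∉Sj (V⊆Si (Z⊆V y∈Z)) y∈Sj))
      where
      through-x : InjectsInto (λ T → T ∈ Si choose r × x ∈ T) (λ V → Target V × V ⊆ Si)
      through-x = ⊆⇒InjectsInto λ ((T⊆ , ∣T∣≡r) , x∈T) → ((p⊆p∪q Sj ∘ T⊆ , ∣T∣≡r) , x∈T) , T⊆

  y≢x : y ≢ x
  y≢x refl = ∉Sj x∈Si y∈Sj

  ShiftTarget : Subset n → Set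
  ShiftTarget V = Target V × Nonempty (V ∩ Sj) × y ∉ V × (∀ {v} → v ∈ V → v ∈ Si → v ≡ x)

  shift-injectsInto : 2 ≤ r → InjectsInto (Star r Sj y) ShiftTarget
  shift-injectsInto 2≤r = record
    { to = shift y x
    ; injective = λ ((X⊆ , _) , y∈X) ((X′⊆ , _) , y∈X′) →
        shift-injective y∈X (∉Sj x∈Si ∘ X⊆) y∈X′ (∉Sj x∈Si ∘ X′⊆)
    ; maps = λ {X} ((X⊆ , ∣X∣≡r) , y∈X) →
        let (w , w∈X , w≢y) = ∃-other-element y∈X (subst (2 ≤_) (sym ∣X∣≡r) 2≤r) in
        ((shift-⊆ (q⊆p∪q Si Sj ∘ X⊆) (p⊆p∪q Sj x∈Si) , trans (shift-size y∈X (∉Sj x∈Si ∘ X⊆)) ∣X∣≡r) ,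
          ∈-shift y x X) ,
        (w , x∈p∩q⁺ (∈-shift⁺ w∈X w≢y , X⊆ w∈X)) ,
        ∉-shift y≢x ,
        only-x X⊆
    }
    where
    only-x : ∀ {X v} → X ⊆ Sj → v ∈ shift y x X → v ∈ Si → v ≡ x
    only-x {v = v} X⊆ v∈ v∈Si with v ≟ᶠ x
    ... | yes v≡x = v≡x
    ... | no v≢x = ⊥-elim (∉Sj v∈Si (X⊆ (proj₁ (∈-shift⁻ v∈ v≢x))))

  ⊆Sj-y : ∀ {X} → X ∈ Sj choose r → y ∉ X → X ⊆ Sj - y
  ⊆Sj-y (X⊆ , _) y∉X v∈X = x∈p∧x≢y⇒x∈p-y (X⊆ v∈X) (λ { refl → y∉X v∈X })

  module _ {W : Subset n} (W⊆Si-x : W ⊆ Si - x) where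

    W⁺⊆Si : W ∪ ⁅ x ⁆ ⊆ Si
    W⁺⊆Si = ⊆p-x⇒∪⁅x⁆⊆p x∈Si W⊆Si-x

    ∣W⁺∣≡1+∣W∣ : ∣ W ∪ ⁅ x ⁆ ∣ ≡ suc ∣ W ∣
    ∣W⁺∣≡1+∣W∣ = x∉p⇒∣p∪⁅x⁆∣≡1+∣p∣ (⊆p-x⇒x∉ W⊆Si-x)

    x∈W⁺ : x ∈ W ∪ ⁅ x ⁆
    x∈W⁺ = q⊆p∪q W ⁅ x ⁆ (x∈⁅x⁆ x)

    Sj-complement-injectsInto : ∣ W ∣ + ∣ Sj ∣ ≡ r + r → r < ∣ Sj - y ∣ →
      InjectsInto (λ X → X ∈ Sj choose r × y ∉ X) (λ V → Target V × Nonempty (V ∩ Sj) × y ∉ V × W ⊆ V)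
    Sj-complement-injectsInto ∣W∣+∣Sj∣≡2r r<∣Sj-y∣ = record
      { to = λ X → (W ∪ ⁅ x ⁆) ∪ ((Sj - y) ─ X)
      ; injective = λ (X∈ , y∉X) (X′∈ , y∉X′) eq →
          ─-injective (⊆Sj-y X∈ y∉X) (⊆Sj-y X′∈ y∉X′)
            (∪-cancelʳ (rest-disjoint _) (rest-disjoint _)
              (trans (∪-comm _ (W ∪ ⁅ x ⁆)) (trans eq (∪-comm (W ∪ ⁅ x ⁆) _))))
      ; maps = λ {X} (X∈ , y∉X) →
          let (v , v∈Sj-y , v∉X) =
                ∣p∣<∣q∣⇒∃x∈q∖p X (Sj - y) (subst (_< ∣ Sj - y ∣) (sym (proj₂ X∈)) r<∣Sj-y∣) in
          ((⊆Si∪Sj W⁺⊆Si (p─q⊆p Sj ⁅ y ⁆ ∘ p─q⊆p (Sj - y) X) , size X∈ y∉X) , p⊆p∪q _ x∈W⁺) ,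
          (v , x∈p∩q⁺ (q⊆p∪q _ _ (x∈p∧x∉q⇒x∈p─q v∈Sj-y v∉X) , p─q⊆p Sj ⁅ y ⁆ v∈Sj-y)) ,
          y∉ X ,
          p⊆p∪q _ ∘ p⊆p∪q ⁅ x ⁆
      }
      where
      rest-disjoint : ∀ X → Empty (((Sj - y) ─ X) ∩ (W ∪ ⁅ x ⁆))
      rest-disjoint X = subst Empty (∩-comm (W ∪ ⁅ x ⁆) _)
        (⊆Si-⊆Sj-disjoint W⁺⊆Si (p─q⊆p Sj ⁅ y ⁆ ∘ p─q⊆p (Sj - y) X))
      y∉ : ∀ X → y ∉ (W ∪ ⁅ x ⁆) ∪ ((Sj - y) ─ X)
      y∉ X y∈ with x∈p∪q⁻ (W ∪ ⁅ x ⁆) _ y∈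
      ... | inj₁ y∈W⁺ = ∉Sj (W⁺⊆Si y∈W⁺) y∈Sj
      ... | inj₂ y∈rest = x∈p-y⇒x≢y (p─q⊆p (Sj - y) X y∈rest) refl
      size : ∀ {X} → X ∈ Sj choose r → y ∉ X → ∣ (W ∪ ⁅ x ⁆) ∪ ((Sj - y) ─ X) ∣ ≡ r
      size {X} X∈ y∉X = +-cancelˡ-≡ r _ _ (begin
        r + ∣ (W ∪ ⁅ x ⁆) ∪ ((Sj - y) ─ X) ∣
          ≡⟨ cong (r +_) (∣p∪q∣≡∣p∣+∣q∣ _ _ (subst Empty (∩-comm _ (W ∪ ⁅ x ⁆)) (rest-disjoint X))) ⟩
        r + (∣ W ∪ ⁅ x ⁆ ∣ + ∣ (Sj - y) ─ X ∣)   ≡⟨ x∙yz≈y∙xz r ∣ W ∪ ⁅ x ⁆ ∣ ∣ (Sj - y) ─ X ∣ ⟩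
        ∣ W ∪ ⁅ x ⁆ ∣ + (r + ∣ (Sj - y) ─ X ∣)   ≡⟨ cong₂ _+_ ∣W⁺∣≡1+∣W∣ (cong (_+ _) (sym (proj₂ X∈))) ⟩
        suc ∣ W ∣ + (∣ X ∣ + ∣ (Sj - y) ─ X ∣)
          ≡⟨ cong (suc ∣ W ∣ +_) (q⊆p⇒∣p∣≡∣q∣+∣p─q∣ (Sj - y) X (⊆Sj-y X∈ y∉X)) ⟨
        suc ∣ W ∣ + ∣ Sj - y ∣                   ≡⟨ +-suc ∣ W ∣ _ ⟨
        ∣ W ∣ + suc ∣ Sj - y ∣                   ≡⟨ cong (∣ W ∣ +_) (x∈p⇒∣p∣≡1+∣p-x∣ y∈Sj) ⟨
        ∣ W ∣ + ∣ Sj ∣                           ≡⟨ ∣W∣+∣Sj∣≡2r ⟩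
        r + r                                    ∎)
        where open ≡-Reasoning

    -- If ∣ Sj ∣ = r + 1, the only r-subset of Sj avoiding y is Sj - y.
    Sj-minus-y-injectsInto : suc (suc ∣ W ∣) ≡ r → ∣ Sj ∣ ≡ suc r → ∀ {z₀} → z₀ ∈ Sj → z₀ ≢ y →
      InjectsInto (λ X → X ∈ Sj choose r × y ∉ X) (λ V → Target V × Nonempty (V ∩ Sj) × y ∈ V × z₀ ∉ V)
    Sj-minus-y-injectsInto ∣W∣+2≡r ∣Sj∣≡1+r {z₀} z₀∈Sj z₀≢y = subsingleton-InjectsInto
      (λ X∈ X′∈ → trans (≡Sj-y X∈) (sym (≡Sj-y X′∈)))
      (((⊆Si∪Sj W⁺⊆Si (x∈p⇒⁅x⁆⊆p y∈Sj) , trans (x∉p⇒∣p∪⁅x⁆∣≡1+∣p∣ y∉W⁺) (trans (cong suc ∣W⁺∣≡1+∣W∣) ∣W∣+2≡r)) ,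
        p⊆p∪q ⁅ y ⁆ x∈W⁺) ,
       (y , x∈p∩q⁺ (y∈ , y∈Sj)) , y∈ , z₀∉)
      where
      ∣Sj-y∣≡r : ∣ Sj - y ∣ ≡ r
      ∣Sj-y∣≡r = suc-injective (trans (sym (x∈p⇒∣p∣≡1+∣p-x∣ y∈Sj)) ∣Sj∣≡1+r)
      ≡Sj-y : ∀ {X} → X ∈ Sj choose r × y ∉ X → X ≡ Sj - y
      ≡Sj-y (X∈ , y∉X) = p⊆q∧∣p∣≡∣q∣⇒p≡q (⊆Sj-y X∈ y∉X) (trans (proj₂ X∈) (sym ∣Sj-y∣≡r))
      y∉W⁺ : y ∉ W ∪ ⁅ x ⁆
      y∉W⁺ y∈W⁺ = ∉Sj (W⁺⊆Si y∈W⁺) y∈Sj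
      y∈ : y ∈ (W ∪ ⁅ x ⁆) ∪ ⁅ y ⁆
      y∈ = q⊆p∪q (W ∪ ⁅ x ⁆) ⁅ y ⁆ (x∈⁅x⁆ y)
      z₀∉ : z₀ ∉ (W ∪ ⁅ x ⁆) ∪ ⁅ y ⁆
      z₀∉ z₀∈ with x∈p∪q⁻ (W ∪ ⁅ x ⁆) ⁅ y ⁆ z₀∈
      ... | inj₁ z₀∈W⁺ = ∉Sj (W⁺⊆Si z₀∈W⁺) z₀∈Sj
      ... | inj₂ z₀∈⁅y⁆ = z₀≢y (x∈⁅y⁆⇒x≡y y z₀∈⁅y⁆)

  module _ (2≤r : 2 ≤ r) {Z : Subset n} (y∈Z : y ∈ Z) where

    SjTarget : Subset n → Set
    SjTarget V = Target V × Nonempty (V ∩ Sj) × ¬ Z ⊆ V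

    avoiding-y : ∀ {V} → ShiftTarget V → SjTarget V
    avoiding-y (V∈ , meets , y∉V , _) = V∈ , meets , λ Z⊆V → y∉V (Z⊆V y∈Z)

    Sj-star-injectsInto : InjectsInto (Star r Sj y) SjTarget
    Sj-star-injectsInto = InjectsInto-⊆ id avoiding-y (shift-injectsInto 2≤r)

    Sj-choose-injectsInto-∣Sj∣≡r : ∣ Sj ∣ ≡ r → InjectsInto (_∈ Sj choose r) SjTarget
    Sj-choose-injectsInto-∣Sj∣≡r ∣Sj∣≡r = InjectsInto-trans (⊆⇒InjectsInto through-y) Sj-star-injectsInto
      where
      through-y : ∀ {X} → X ∈ Sj choose r → Star r Sj y X
      through-y (X⊆ , ∣X∣≡r) =
        (X⊆ , ∣X∣≡r) , subst (y ∈_) (sym (p⊆q∧∣p∣≡∣q∣⇒p≡q X⊆ (trans ∣X∣≡r (sym ∣Sj∣≡r)))) y∈Sj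

    split-at-y : ∀ {Q} → InjectsInto (λ X → X ∈ Sj choose r × y ∉ X) Q → (∀ {V} → Q V → SjTarget V) →
      (∀ {V} → ShiftTarget V → ¬ Q V) →
      InjectsInto (_∈ Sj choose r) SjTarget
    split-at-y κ Q⊆ disjoint = InjectsInto-⊆ id [ avoiding-y , Q⊆ ]′
      (InjectsInto-if (y ∈?_) (shift-injectsInto 2≤r) κ disjoint)

    module _ (r≤∣Si∣ : r ≤ ∣ Si ∣) where

      ∣Si∣≡1+∣Si-x∣ : ∣ Si ∣ ≡ suc ∣ Si - x ∣
      ∣Si∣≡1+∣Si-x∣ = x∈p⇒∣p∣≡1+∣p-x∣ x∈Si

      Sj-choose-injectsInto-∣Sj∣≡1+r : ∀ {z₀} → z₀ ∈ Z → z₀ ∈ Sj → z₀ ≢ y → ∣ Sj ∣ ≡ suc r →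
        InjectsInto (_∈ Sj choose r) SjTarget
      Sj-choose-injectsInto-∣Sj∣≡1+r z₀∈Z z₀∈Sj z₀≢y ∣Sj∣≡1+r with m≤n⇒∃[o]m+o≡n 2≤r
      ... | k , 2+k≡r with ∃-⊆-of-size k (Si - x)
          (≤-trans (n≤1+n k) (≤-pred (subst (2 + k ≤_) ∣Si∣≡1+∣Si-x∣
                                               (subst (_≤ ∣ Si ∣) (sym 2+k≡r) r≤∣Si∣))))
      ...   | W , W⊆Si-x , ∣W∣≡k =
        split-at-y (Sj-minus-y-injectsInto W⊆Si-x (trans (cong (suc ∘ suc) ∣W∣≡k) 2+k≡r) ∣Sj∣≡1+r z₀∈Sj z₀≢y)
          (λ (V∈ , meets , _ , z₀∉V) → V∈ , meets , λ Z⊆V → z₀∉V (Z⊆V z₀∈Z))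
          (λ (_ , _ , y∉V , _) (_ , _ , y∈V , _) → y∉V y∈V)

      -- The members avoiding y are mapped to sets containing a point w ∈ Si other than x,
      -- which the images of the shift y ↦ x never contain.
      Sj-choose-injectsInto-∣Sj∣>1+r : suc r < ∣ Sj ∣ → ∣ Sj ∣ < r + r → InjectsInto (_∈ Sj choose r) SjTarget
      Sj-choose-injectsInto-∣Sj∣>1+r 1+r<∣Sj∣ ∣Sj∣<2r with m≤n⇒∃[o]m+o≡n (<⇒≤ ∣Sj∣<2r)
      ... | c , ∣Sj∣+c≡2r
        with ∃-⊆-of-size c (Si - x) (≤-pred (subst (c <_) ∣Si∣≡1+∣Si-x∣ (<-≤-trans c<r r≤∣Si∣)))
        where
        c<r : c < r
        c<r = +-cancelʳ-< ∣ Sj ∣ c r (subst (_< r + ∣ Sj ∣) (trans (sym ∣Sj∣+c≡2r) (+-comm ∣ Sj ∣ c))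
                                       (+-monoʳ-< r (<-trans (n<1+n r) 1+r<∣Sj∣)))
      ...   | W , W⊆Si-x , ∣W∣≡c with 0<∣p∣⇒Nonempty {p = W} (subst (0 <_) (sym ∣W∣≡c) 0<c)
        where
        0<c : 0 < c
        0<c = n≢0⇒n>0 λ c≡0 →
          <-irrefl (trans (sym (+-identityʳ _)) (subst (λ t → ∣ Sj ∣ + t ≡ r + r) c≡0 ∣Sj∣+c≡2r)) ∣Sj∣<2r
      ...     | w , w∈W =
        split-at-y (Sj-complement-injectsInto W⊆Si-x
                      (trans (cong (_+ ∣ Sj ∣) ∣W∣≡c) (trans (+-comm c _) ∣Sj∣+c≡2r))
                      (≤-pred (subst (suc r <_) (x∈p⇒∣p∣≡1+∣p-x∣ y∈Sj) 1+r<∣Sj∣)))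
          (λ (V∈ , meets , y∉V , _) → V∈ , meets , λ Z⊆V → y∉V (Z⊆V y∈Z))
          (λ (_ , _ , _ , only-x) (_ , _ , _ , W⊆V) →
             x∈p-y⇒x≢y (W⊆Si-x w∈W) (only-x (W⊆V w∈W) (p─q⊆p Si ⁅ x ⁆ (W⊆Si-x w∈W))))

      Sj-choose-injectsInto : ∀ {z₀} → z₀ ∈ Z → z₀ ∈ Sj → z₀ ≢ y → r ≤ ∣ Sj ∣ → ∣ Sj ∣ < r + r →
        InjectsInto (_∈ Sj choose r) SjTarget
      Sj-choose-injectsInto z₀∈Z z₀∈Sj z₀≢y r≤∣Sj∣ ∣Sj∣<2r with ∣ Sj ∣ ≟ r | ∣ Sj ∣ ≟ suc r
      ... | yes ∣Sj∣≡r | _              = Sj-choose-injectsInto-∣Sj∣≡r ∣Sj∣≡r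
      ... | no _       | yes ∣Sj∣≡1+r   = Sj-choose-injectsInto-∣Sj∣≡1+r z₀∈Z z₀∈Sj z₀≢y ∣Sj∣≡1+r
      ... | no ∣Sj∣≢r  | no ∣Sj∣≢1+r   =
        Sj-choose-injectsInto-∣Sj∣>1+r (≤∧≢⇒< (≤∧≢⇒< r≤∣Sj∣ (∣Sj∣≢r ∘ sym)) (∣Sj∣≢1+r ∘ sym)) ∣Sj∣<2r

      Sj-intersecting-injectsInto : ∀ {z₀} → z₀ ∈ Z → z₀ ∈ Sj → z₀ ≢ y → r ≤ ∣ Sj ∣ →
        ∀ {B} → Uniform r Sj B → Intersecting B → InjectsInto (_∈ₗ B) SjTarget
      Sj-intersecting-injectsInto z₀∈Z z₀∈Sj z₀≢y r≤∣Sj∣ B-uniform B-int with r + r ≤? ∣ Sj ∣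
      ... | yes 2r≤∣Sj∣ = InjectsInto-trans
        (intersecting-injectsInto-star ∣ Sj ∣ refl (<-≤-trans (s≤s z≤n) 2≤r) 2r≤∣Sj∣ y∈Sj B-uniform B-int)
        Sj-star-injectsInto
      ... | no 2r≰∣Sj∣ = InjectsInto-trans (⊆⇒InjectsInto B-uniform)
        (Sj-choose-injectsInto z₀∈Z z₀∈Sj z₀≢y r≤∣Sj∣ (≰⇒> 2r≰∣Sj∣))

  -- Z pads Si ─ T to an r-set; its point z₀ ≠ y keeps these sets apart from W ∪ ⁅ x ⁆ ∪ ⁅ y ⁆.
  record Padding : Set where
    field
      Z           : Subset n
      Z⊆Sj        : Z ⊆ Sj
      ∣Si∣+∣Z∣≡2r : ∣ Si ∣ + ∣ Z ∣ ≡ r + r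
      y∈Z         : y ∈ Z
      z₀          : Fin n
      z₀∈Z        : z₀ ∈ Z
      z₀≢y        : z₀ ≢ y

  padding : r ≤ ∣ Si ∣ → 2 + ∣ Si ∣ ≤ r + r → r ≤ ∣ Sj ∣ → Padding
  padding r≤∣Si∣ 2+∣Si∣≤2r r≤∣Sj∣ =
    let (d , 2+∣Si∣+d≡2r) = m≤n⇒∃[o]m+o≡n 2+∣Si∣≤2r in
    padding-of-size d (trans (+-suc ∣ Si ∣ (suc d)) (trans (cong suc (+-suc ∣ Si ∣ d)) 2+∣Si∣+d≡2r))
    where
    padding-of-size : ∀ d → ∣ Si ∣ + suc (suc d) ≡ r + r → Padding
    padding-of-size d ∣Si∣+2+d≡2r with ∃-⊆-of-size-∋ (suc d) y∈Sj
      (≤-trans (+-cancelˡ-≤ r _ _ (≤-trans (+-monoˡ-≤ (suc (suc d)) r≤∣Si∣) (≤-reflexive ∣Si∣+2+d≡2r))) r≤∣Sj∣)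
    ... | Z , Z⊆Sj , y∈Z , ∣Z∣≡2+d with ∃-other-element y∈Z (subst (1 <_) (sym ∣Z∣≡2+d) (s≤s (s≤s z≤n)))
    ...   | z₀ , z₀∈Z , z₀≢y = record
      { Z = Z ; Z⊆Sj = Z⊆Sj ; ∣Si∣+∣Z∣≡2r = trans (cong (∣ Si ∣ +_) ∣Z∣≡2+d) ∣Si∣+2+d≡2r
      ; y∈Z = y∈Z ; z₀ = z₀ ; z₀∈Z = z₀∈Z ; z₀≢y = z₀≢y }

  merged-injectsInto : 2 ≤ r → r ≤ ∣ Si ∣ → 2 + ∣ Si ∣ ≤ r + r → r ≤ ∣ Sj ∣ →
    ∀ {B} → Uniform r Sj B → Intersecting B → InjectsInto (λ X → X ∈ Si choose r ⊎ X ∈ₗ B) Target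
  merged-injectsInto 2≤r r≤∣Si∣ 2+∣Si∣≤2r r≤∣Sj∣ {B} B-uniform B-int =
    InjectsInto-⊆ id [ proj₁ , proj₁ ]′ (InjectsInto-if (_⊆? Si) from-Si from-B disjoint)
    where
    open Padding (padding r≤∣Si∣ 2+∣Si∣≤2r r≤∣Sj∣)
    from-Si : InjectsInto (λ X → (X ∈ Si choose r ⊎ X ∈ₗ B) × X ⊆ Si) (λ V → Target V × (V ⊆ Si ⊎ Z ⊆ V))
    from-Si = InjectsInto-⊆ (λ { (inj₁ X∈ , _) → X∈ ; (inj₂ X∈B , X⊆Si) → ⊥-elim (nonempty-in-both X∈B X⊆Si) })
      id (Si-choose-injectsInto Z⊆Sj ∣Si∣+∣Z∣≡2r y∈Z)
      where
      nonempty-in-both : ∀ {X} → X ∈ₗ B → ¬ X ⊆ Si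
      nonempty-in-both X∈B X⊆Si =
        let (X⊆Sj , ∣X∣≡r) = B-uniform X∈B
            (v , v∈X) = 0<∣p∣⇒Nonempty (subst (0 <_) (sym ∣X∣≡r) (<-≤-trans (s≤s z≤n) 2≤r))
        in ∉Sj (X⊆Si v∈X) (X⊆Sj v∈X)
    from-B : InjectsInto (λ X → (X ∈ Si choose r ⊎ X ∈ₗ B) × ¬ X ⊆ Si) (SjTarget 2≤r y∈Z)
    from-B = InjectsInto-⊆ (λ { (inj₁ (X⊆Si , _) , X⊈Si) → ⊥-elim (X⊈Si X⊆Si) ; (inj₂ X∈B , _) → X∈B })
      id (Sj-intersecting-injectsInto 2≤r y∈Z r≤∣Si∣ z₀∈Z (Z⊆Sj z₀∈Z) z₀≢y r≤∣Sj∣ B-uniform B-int)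
    disjoint : ∀ {V} → Target V × (V ⊆ Si ⊎ Z ⊆ V) → ¬ SjTarget 2≤r y∈Z V
    disjoint (_ , inj₁ V⊆Si) (_ , (w , w∈) , _) = let (w∈V , w∈Sj) = x∈p∩q⁻ _ Sj w∈ in ∉Sj (V⊆Si w∈V) w∈Sj
    disjoint (_ , inj₂ Z⊆V) (_ , _ , Z⊈V) = Z⊈V Z⊆V

-- Recolouring an independent set

module _ {k n : ℕ} (S : Fin k → Subset n) (i j : Fin k) where

  merge-i : merge S i j i ≡ S i ∪ S j
  merge-i with i ≟ᶠ i
  ... | yes _  = refl
  ... | no i≢i = ⊥-elim (i≢i refl)

  merge-other : ∀ {c} → c ≢ i → c ≢ j → merge S i j c ≡ S c
  merge-other {c} c≢i c≢j with c ≟ᶠ i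
  ... | yes c≡i = ⊥-elim (c≢i c≡i)
  ... | no _ with c ≟ᶠ j
  ...   | yes c≡j = ⊥-elim (c≢j c≡j)
  ...   | no _    = refl

  relabel : (Subset n → Subset n) → Vertex k n → Vertex k n
  relabel f (c , X) with c ≟ᶠ i | c ≟ᶠ j
  ... | no _ | no _ = c , X
  ... | _    | _    = i , f X

  data RelabelView (f : Subset n → Subset n) : Vertex k n → Vertex k n → Set where
    merged : ∀ {c X} → c ≡ i ⊎ c ≡ j → RelabelView f (c , X) (i , f X)
    other  : ∀ {c X} → c ≢ i → c ≢ j → RelabelView f (c , X) (c , X)

  relabel-view : ∀ f v → RelabelView f v (relabel f v)
  relabel-view f (c , X) with c ≟ᶠ i | c ≟ᶠ j
  ... | no c≢i  | no c≢j = other c≢i c≢j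
  ... | yes c≡i | _      = merged (inj₁ c≡i)
  ... | no _    | yes c≡j = merged (inj₂ c≡j)

Adj-sym : ∀ {k n} {u v : Vertex k n} → Adj u v → Adj v u
Adj-sym {u = c , X} {v = c′ , X′} (inj₁ (c≡c′ , X∩X′-empty)) =
  inj₁ (sym c≡c′ , X∩X′-empty ∘ subst Nonempty (∩-comm X′ X))
Adj-sym {u = c , X} {v = c′ , X′} (inj₂ (c≢c′ , X∩X′-meet)) =
  inj₂ (c≢c′ ∘ sym , subst Nonempty (∩-comm X X′) X∩X′-meet)

module _ {k n r : ℕ} {S : Fin k → Subset n} {I : List (Vertex k n)} (I-indep : IsIndepIn r S I) where

  private
    I-unique = proj₁ I-indep
    I-vertices = proj₁ (proj₂ I-indep)
    I-within = proj₁ (proj₂ (proj₂ I-indep))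
    I-nonadjacent = proj₂ (proj₂ (proj₂ I-indep))

  ∈⇒∈choose : ∀ {c X} → (c , X) ∈ₗ I → X ∈ S c choose r
  ∈⇒∈choose v∈I = I-within v∈I , I-vertices v∈I

  colour-class : Fin k → List (Subset n)
  colour-class c = map proj₂ (filter ((_≟ᶠ c) ∘ proj₁) I)

  ∈-colour-class⁺ : ∀ {c X} → (c , X) ∈ₗ I → X ∈ₗ colour-class c
  ∈-colour-class⁺ v∈I = ∈-map⁺ proj₂ (∈-filter⁺ ((_≟ᶠ _) ∘ proj₁) v∈I refl)

  ∈-colour-class⁻ : ∀ {c X} → X ∈ₗ colour-class c → (c , X) ∈ₗ I
  ∈-colour-class⁻ {c} X∈ with ∈-map⁻ proj₂ X∈
  ... | (c′ , X) , v∈ , refl with ∈-filter⁻ ((_≟ᶠ c) ∘ proj₁) {xs = I} v∈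
  ...   | v∈I , refl = v∈I

  colour-class-uniform : ∀ {c} → Uniform r (S c) (colour-class c)
  colour-class-uniform X∈ = ∈⇒∈choose (∈-colour-class⁻ X∈)

  colour-class-intersecting : ∀ {c} → Intersecting (colour-class c)
  colour-class-intersecting {X = X} {Y} X∈ Y∈ with nonempty? (X ∩ Y)
  ... | yes X∩Y-meet = X∩Y-meet
  ... | no X∩Y-empty =
    ⊥-elim (I-nonadjacent (∈-colour-class⁻ X∈) (∈-colour-class⁻ Y∈) (inj₁ (refl , X∩Y-empty)))

  same-set⇒same-colour : 0 < r → ∀ {c c′ X} → (c , X) ∈ₗ I → (c′ , X) ∈ₗ I → c ≡ c′
  same-set⇒same-colour 0<r {c} {c′} {X} v∈I v′∈I with c ≟ᶠ c′
  ... | yes c≡c′ = c≡c′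
  ... | no c≢c′ = ⊥-elim (I-nonadjacent v∈I v′∈I (inj₂ (c≢c′ , subst Nonempty (sym (∩-idem X)) X-nonempty)))
    where
    X-nonempty : Nonempty X
    X-nonempty = 0<∣p∣⇒Nonempty (subst (0 <_) (sym (I-vertices v∈I)) 0<r)

  module _ {i j : Fin k} {x : Fin n} (0<r : 0 < r) (S-disjoint : ∀ a b → a ≢ b → Empty (S a ∩ S b))
    (κ : InjectsInto (λ X → (i , X) ∈ₗ I ⊎ (j , X) ∈ₗ I) (Star r (S i ∪ S j) x)) where

    private
      relabelκ = relabel S i j (to κ)

      in-domain : ∀ {c X} → (c , X) ∈ₗ I → c ≡ i ⊎ c ≡ j → (i , X) ∈ₗ I ⊎ (j , X) ∈ₗ I
      in-domain v∈I (inj₁ refl) = inj₁ v∈I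
      in-domain v∈I (inj₂ refl) = inj₂ v∈I

    relabel-injective : ∀ {u v} → u ∈ₗ I → v ∈ₗ I → relabelκ u ≡ relabelκ v → u ≡ v
    relabel-injective {u} {v} u∈I v∈I eq
      with relabelκ u | relabel-view S i j (to κ) u | relabelκ v | relabel-view S i j (to κ) v
    ... | _ | merged c∈ij | _ | merged c′∈ij
      with injective κ (in-domain u∈I c∈ij) (in-domain v∈I c′∈ij) (cong proj₂ eq)
    ...   | refl = cong (_, _) (same-set⇒same-colour 0<r u∈I v∈I)
    relabel-injective u∈I v∈I eq | _ | merged _ | _ | other c′≢i _ = ⊥-elim (c′≢i (sym (cong proj₁ eq)))
    relabel-injective u∈I v∈I eq | _ | other c≢i _ | _ | merged _ = ⊥-elim (c≢i (cong proj₁ eq))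
    relabel-injective u∈I v∈I eq | _ | other _ _ | _ | other _ _ = eq

    private
      ∈-relabelled⁻ : ∀ {w} → w ∈ₗ map relabelκ I → ∃ λ v → v ∈ₗ I × RelabelView S i j (to κ) v w
      ∈-relabelled⁻ w∈ with ∈-map⁻ relabelκ w∈
      ... | v , v∈I , refl = v , v∈I , relabel-view S i j (to κ) v

      merged-other-nonadjacent : ∀ {X c′ X′} → (i , X) ∈ₗ I ⊎ (j , X) ∈ₗ I → (c′ , X′) ∈ₗ I →
        c′ ≢ i → c′ ≢ j → ¬ Adj (i , to κ X) (c′ , X′)
      merged-other-nonadjacent _ _ c′≢i _ (inj₁ (i≡c′ , _)) = c′≢i (sym i≡c′)
      merged-other-nonadjacent {X} {c′} {X′} X∈ v′∈I c′≢i c′≢j (inj₂ (_ , w , w∈)) with x∈p∩q⁻ (to κ X) X′ w∈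
      ... | w∈κX , w∈X′ with x∈p∪q⁻ (S i) (S j) (proj₁ (proj₁ (maps κ X∈)) w∈κX)
      ...   | inj₁ w∈Si = S-disjoint c′ i c′≢i (w , x∈p∩q⁺ (I-within v′∈I w∈X′ , w∈Si))
      ...   | inj₂ w∈Sj = S-disjoint c′ j c′≢j (w , x∈p∩q⁺ (I-within v′∈I w∈X′ , w∈Sj))

    relabel-independent : IsIndepIn r (merge S i j) (map relabelκ I)
    relabel-independent = Unique-map⁺ relabel-injective I-unique , vertices , within , nonadjacent
      where
      vertices : ∀ {w} → w ∈ₗ map relabelκ I → IsVertex r w
      vertices w∈ with ∈-relabelled⁻ w∈
      ... | _ , v∈I , merged c∈ij = proj₂ (proj₁ (maps κ (in-domain v∈I c∈ij)))
      ... | _ , v∈I , other _ _   = I-vertices v∈I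
      within : ∀ {c X} → (c , X) ∈ₗ map relabelκ I → X ⊆ merge S i j c
      within w∈ with ∈-relabelled⁻ w∈
      ... | _ , v∈I , merged c∈ij =
        subst (_ ⊆_) (sym (merge-i S i j)) (proj₁ (proj₁ (maps κ (in-domain v∈I c∈ij))))
      ... | _ , v∈I , other c≢i c≢j = subst (_ ⊆_) (sym (merge-other S i j c≢i c≢j)) (I-within v∈I)
      nonadjacent : ∀ {u v} → u ∈ₗ map relabelκ I → v ∈ₗ map relabelκ I → ¬ Adj u v
      nonadjacent u∈ v∈ with ∈-relabelled⁻ u∈ | ∈-relabelled⁻ v∈
      ... | _ , u∈I , merged c∈ij | _ , v∈I , merged c′∈ij = λ
        { (inj₁ (_ , disjoint)) → disjoint (x , x∈p∩q⁺ (proj₂ (maps κ (in-domain u∈I c∈ij)) ,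
                                                       proj₂ (maps κ (in-domain v∈I c′∈ij))))
        ; (inj₂ (i≢i , _)) → i≢i refl }
      ... | _ , u∈I , merged c∈ij | _ , v∈I , other c′≢i c′≢j =
        merged-other-nonadjacent (in-domain u∈I c∈ij) v∈I c′≢i c′≢j
      ... | _ , u∈I , other c≢i c≢j | _ , v∈I , merged c′∈ij =
        merged-other-nonadjacent (in-domain v∈I c′∈ij) u∈I c≢i c≢j ∘ Adj-sym
      ... | _ , u∈I , other _ _ | _ , v∈I , other _ _ = I-nonadjacent u∈I v∈I

lemma4p22 : (r k n : ℕ) → 2 ≤ r → 1 ≤ k → 2 * r ≤ n →
    (S : Fin k → Subset n) → IsAdmissiblePartition r S →
    (∃₂ λ a b → a ≢ b × Nonempty (S a) × Nonempty (S b)) →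
    (i j : Fin k) → r ≤ ∣ S i ∣ → ∣ S i ∣ ≤ 2 * r ∸ 2 →
    j ≢ i → Nonempty (S j) →
    (m m′ : ℕ) → IsAlpha r S m → IsAlpha r (merge S i j) m′ → m ≤ m′
lemma4p22 r _ _ 2≤r _ _ S (S-disjoint , _ , S-sizes) _ i j r≤∣Si∣ ∣Si∣≤2r∸2 j≢i (y , y∈Sj) m m′
  ((I , I-indep , ∣I∣≡m) , _) (_ , m′-maximal) = begin
    m                            ≡⟨ ∣I∣≡m ⟨
    length I                     ≡⟨ length-map _ I ⟨
    length (map _ I)             ≤⟨ m′-maximal _ (relabel-independent I-indep 0<r S-disjoint κ) ⟩
    m′                           ∎
  where
  open ≤-Reasoning
  0<r = ≤-trans (s≤s z≤n) 2≤r
  x∈Si = proj₂ (0<∣p∣⇒Nonempty (≤-trans 0<r r≤∣Si∣))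
  r≤∣Sj∣ : r ≤ ∣ S j ∣
  r≤∣Sj∣ = [ (λ Sj-empty → ⊥-elim (Sj-empty (y , y∈Sj))) , id ]′ (S-sizes j)
  2+∣Si∣≤2r : 2 + ∣ S i ∣ ≤ r + r
  2+∣Si∣≤2r = subst₂ _≤_ (+-comm ∣ S i ∣ 2) (cong (r +_) (+-identityʳ r))
    (m≤o∸n⇒m+n≤o ∣ S i ∣ (≤-trans 2≤r (m≤m+n r _)) ∣Si∣≤2r∸2)
  κ = InjectsInto-⊆ [ inj₁ ∘ ∈⇒∈choose I-indep , inj₂ ∘ ∈-colour-class⁺ I-indep ]′ id
        (MergedStar.merged-injectsInto (S-disjoint i j (j≢i ∘ sym)) x∈Si y∈Sj 2≤r r≤∣Si∣ 2+∣Si∣≤2r r≤∣Sj∣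
           (colour-class-uniform I-indep) (colour-class-intersecting I-indep))
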